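{- Let $f\in F(n)$ and let $d$ be the number of images of $f^2=f\circ f$ (i.e. $d=|f^2(\{0,1\}^n)|$). Then there exists $h\in F(n)$ with $h\sim f$ such that $\mathcal{A}(h)$ has at least $\lfloor d/10\rfloor$ attractors, each of size at most $4$.
   Context: $F(n)$ is the set of all functions $\{0,1\}^n\to\{0,1\}^n$, written $h=(h_1,\dots,h_n)$. $e_i$ is the configuration with a $1$ exactly in component $i$; addition is componentwise mod $2$. $\mathcal{A}(h)$ is the digraph on $\{0,1\}^n$ with an arc $x\to x+e_i$ whenever $h_i(x)\neq x_i$. An attractor is an inclusion-minimal non-empty set of configurations with no arc leaving it. $h\sim f$ means the digraphs $\mathcal{S}(h)$, $\mathcal{S}(f)$ (arcs $x\to h(x)$, resp. $x\to f(x)$) are isomorphic. -}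

module Defs where

open import Data.Bool using (Bool; true; false; not)
open import Data.Bool.Properties using () renaming (_≟_ to _≟ᵇ_)
open import Data.Nat using (ℕ; zero; suc; _≤_; _/_)
open import Data.Fin using (Fin)
open import Data.Vec using (Vec; []; _∷_; lookup; updateAt)
open import Data.Vec.Properties using (≡-dec)
open import Data.List using (List; [_]; _++_; map; filter; length)
open import Data.List.Relation.Unary.Any using (any?)
open import Data.List.Relation.Unary.All using (All)
open import Data.List.Relation.Unary.AllPairs using (AllPairs)
open import Data.Product using (Σ; ∃; _×_; _,_)
open import Function.Bundles using (_⤖_; Bijection)
open import Relation.Binary.PropositionalEquality using (_≡_; _≢_)
open import Relation.Binary.Definitions using (DecidableEquality)
open import Relation.Nullary using (Dec)

Config : ℕ → Set
Config n = Vec Bool n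

F : ℕ → Set
F n = Config n → Config n

_≟c_ : ∀ {n} → DecidableEquality (Config n)
_≟c_ = ≡-dec _≟ᵇ_

allConfigs : (n : ℕ) → List (Config n)
allConfigs zero = [ [] ]
allConfigs (suc n) = map (false ∷_) (allConfigs n) ++ map (true ∷_) (allConfigs n)

imageCount2 : ∀ {n} → F n → ℕ
imageCount2 {n} f =
  length (filter (λ y → any? (λ x → f (f x) ≟c y) (allConfigs n)) (allConfigs n))

flipAt : ∀ {n} → Fin n → Config n → Config n
flipAt i x = updateAt x i not

-- arcs of the asynchronous graph A(h): x → x + e_i whenever h_i(x) ≠ x_i
AArc : ∀ {n} → F n → Config n → Config n → Set
AArc h x y = ∃ λ i → (lookup (h x) i ≢ lookup x i) × (y ≡ flipAt i x)

CSet : ℕ → Set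
CSet n = Config n → Bool

_⊆_ : ∀ {n} → CSet n → CSet n → Set
S ⊆ T = ∀ x → S x ≡ true → T x ≡ true

NonEmpty : ∀ {n} → CSet n → Set
NonEmpty S = ∃ λ x → S x ≡ true

Trap : ∀ {n} → F n → CSet n → Set
Trap h S = ∀ x y → S x ≡ true → AArc h x y → S y ≡ true

Attractor : ∀ {n} → F n → CSet n → Set
Attractor h S = NonEmpty S × Trap h S ×
  (∀ T → T ⊆ S → NonEmpty T → Trap h T → S ⊆ T)

size : ∀ {n} → CSet n → ℕ
size {n} S = length (filter (λ x → S x ≟ᵇ true) (allConfigs n))

DistinctSets : ∀ {n} → CSet n → CSet n → Set
DistinctSets S T = ∃ λ x → S x ≢ T x

-- h ∼ f : the synchronous graphs S(h) (x → h x) and S(f) are isomorphic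
_∼_ : ∀ {n} → F n → F n → Set
_∼_ {n} h f = Σ (Config n ⤖ Config n) λ σ →
  ∀ x y → (h x ≡ y → f (Bijection.to σ x) ≡ Bijection.to σ y)
        × (f (Bijection.to σ x) ≡ Bijection.to σ y → h x ≡ y)

{-# OPTIONS --safe #-}
-- Let d be the number of images of f², and choose an f²-preimage x of each of them.  The
-- segments {x, f x, f² x} and {x′, f x′, f² x′} meet only if f² x′ ∈ {x, f x, f³ x, f⁴ x}, so a
-- greedy choice keeps at least d/5 of these segments pairwise disjoint.  A segment contains a
-- fixed point, is a 2-cycle, or is a path of three distinct points; pairing the segments up
-- gives at least ⌊d/10⌋ disjoint gadgets: a fixed point, a 2-cycle, or two disjoint paths.
-- Write configurations as b ++ t with b ∈ {0,1}³ and give every gadget its own tag t (there are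
-- 2ⁿ⁻³ ≥ d/8 of them).  Conjugating f by a permutation that moves the points of a gadget to
-- corners b ++ t gives h ∼ f that fixes 000, swaps 000 and 100, or maps 000 ↦ 100 ↦ 010 and
-- 111 ↦ 110 ↦ 101 in the subcube of t; in 𝒜(h) these yield the attractors {000}, {000, 100}
-- and {000, 100, 110, 111}.  For n ≤ 2 there is nothing to prove, since d ≤ 4.
module Submission where

open import Defs hiding (_⊆_)
open import Level using (0ℓ)
open import Data.Bool using (Bool; true; false)
open import Data.Bool.Properties using () renaming (_≟_ to _≟ᵇ_)
open import Data.Empty using (⊥-elim)
open import Data.Fin using (zero; suc)
open import Data.Nat using (ℕ; zero; suc; _≤_; _<_; _+_; _*_; _^_; _/_; _⊓_; _<?_; z≤n; s≤s; s≤s⁻¹; z<s)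
open import Data.Nat.Properties
  using (≤-refl; ≤-reflexive; ≤-trans; ≤-<-trans; +-comm; +-suc; +-identityʳ; *-suc; +-mono-≤; *-monoʳ-≤;
         m<m+n; ⊓-glb; module ≤-Reasoning)
open import Data.Nat.DivMod using (m<n*o⇒m/o<n; m<n⇒m/n≡0)
open import Data.Nat.Tactic.RingSolver using (solve)
open import Data.Product using (Σ; ∃-syntax; _×_; _,_; proj₁; proj₂)
open import Data.Sum using (inj₁; inj₂)
open import Data.Vec using (Vec; []; _∷_; _++_; lookup)
open import Data.Vec.Properties using (∷-injectiveʳ; ++-injectiveˡ; ++-injectiveʳ)
open import Data.List as List using (List; []; _∷_; [_]; map; length; filter; zip; concatMap)
open import Data.List.Properties using (length-filter; length-map; length-++; length-removeAt′; length-zipWith)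
open import Data.List.Relation.Unary.Any using (Any; here; there; index; any?; satisfied)
open import Data.List.Relation.Unary.All as All using (All; []; _∷_)
import Data.List.Relation.Unary.All.Properties as All
open import Data.List.Relation.Unary.AllPairs as AllPairs using (AllPairs; []; _∷_)
import Data.List.Relation.Unary.AllPairs.Properties as AllPairs
open import Data.List.Relation.Unary.Unique.Propositional using (Unique)
import Data.List.Relation.Unary.Unique.Propositional.Properties as Unique
open import Data.List.Relation.Binary.Subset.Propositional using (_⊆_)
open import Data.List.Relation.Binary.Disjoint.Propositional using (Disjoint)
import Data.List.Relation.Binary.Disjoint.DecPropositional as DecDisjoint
open import Data.List.Membership.Propositional using (_∈_; _∉_; _─_; find; lose)
open import Data.List.Membership.Propositional.Properties
  using (∈-filter⁻; ∈-map⁺; ∈-map⁻; ∈-++⁺ˡ; ∈-++⁺ʳ; ∈-++⁻; ∈-concat⁺′)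
import Data.List.Membership.DecPropositional as DecMembership
open import Function using (id; _∘_; _on_; _↔_; Inverse; mk↔ₛ′)
open import Function.Construct.Identity using (↔-id)
open import Function.Properties.Inverse using (↔⇒⤖)
open import Relation.Binary.Core using (Rel)
open import Relation.Binary.Definitions using (Decidable; DecidableEquality)
open import Relation.Binary.PropositionalEquality
  using (_≡_; _≢_; refl; sym; trans; cong; cong₂; subst; module ≡-Reasoning)
open import Relation.Nullary using (¬_; does; yes; no)
open import Relation.Nullary.Decidable using (dec-true; dec-false; from-yes)
open import Relation.Unary using (Pred) renaming (Decidable to Decidable₁)
open import Relation.Unary.Properties using (∁?)

module _ {A : Set} where

  ∈-─ : ∀ {x y} {ys : List A} (x∈ys : x ∈ ys) → y ∈ ys → x ≢ y → y ∈ ys ─ x∈ys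
  ∈-─ (here refl)  (here refl)  x≢y = ⊥-elim (x≢y refl)
  ∈-─ (here _)     (there y∈ys) _   = y∈ys
  ∈-─ (there _)    (here refl)  _   = here refl
  ∈-─ (there x∈ys) (there y∈ys) x≢y = there (∈-─ x∈ys y∈ys x≢y)

  Unique∧⊆⇒length≤ : ∀ {xs ys : List A} → Unique xs → xs ⊆ ys → length xs ≤ length ys
  Unique∧⊆⇒length≤ {[]}          _            _     = z≤n
  Unique∧⊆⇒length≤ {x ∷ xs} {ys} (x∉xs ∷ xs!) xs⊆ys = begin
    suc (length xs)          ≤⟨ s≤s (Unique∧⊆⇒length≤ xs! xs⊆ys─x) ⟩
    suc (length (ys ─ x∈ys)) ≡⟨ sym (length-removeAt′ ys (index x∈ys)) ⟩
    length ys                ∎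
    where
    open ≤-Reasoning
    x∈ys = xs⊆ys (here refl)
    xs⊆ys─x : xs ⊆ ys ─ x∈ys
    xs⊆ys─x y∈xs = ∈-─ x∈ys (xs⊆ys (there y∈xs)) (All.lookup x∉xs y∈xs)

  module _ {P : Pred A 0ℓ} (P? : Decidable₁ P) where

    length-filter+filter-∁ : ∀ xs → length xs ≡ length (filter P? xs) + length (filter (∁? P?) xs)
    length-filter+filter-∁ [] = refl
    length-filter+filter-∁ (x ∷ xs) with P? x
    ... | yes _ = cong suc (length-filter+filter-∁ xs)
    ... | no  _ = trans (cong suc (length-filter+filter-∁ xs)) (sym (+-suc _ _))

module _ {A : Set} (_≟_ : DecidableEquality A) where
  open DecMembership _≟_ using (_∈?_)

  ¬Disjoint⇒common : ∀ {xs ys : List A} → ¬ Disjoint xs ys → ∃[ v ] v ∈ xs × v ∈ ys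
  ¬Disjoint⇒common {xs} {ys} ¬disjoint with any? (_∈? ys) xs
  ... | yes some = find some
  ... | no  none = ⊥-elim (¬disjoint λ (v∈xs , v∈ys) → none (lose v∈xs v∈ys))

module _ {A B : Set} where

  All-zip⁺ : ∀ {P : Pred A 0ℓ} {Q : Pred B 0ℓ} {xs ys} → All P xs → All Q ys →
             All (λ (a , b) → P a × Q b) (zip xs ys)
  All-zip⁺ []       _        = []
  All-zip⁺ (_ ∷ _)  []       = []
  All-zip⁺ (p ∷ ps) (q ∷ qs) = (p , q) ∷ All-zip⁺ ps qs

  AllPairs-zip⁺ : ∀ {R : Rel A 0ℓ} {S : Rel B 0ℓ} {xs ys} → AllPairs R xs → AllPairs S ys →
                  AllPairs (λ (a , b) (a′ , b′) → R a a′ × S b b′) (zip xs ys)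
  AllPairs-zip⁺ []       _        = []
  AllPairs-zip⁺ (_ ∷ _)  []       = []
  AllPairs-zip⁺ (r ∷ rs) (s ∷ ss) = All-zip⁺ r s ∷ AllPairs-zip⁺ rs ss

m<[1+n]*10⇒m/10≤n : ∀ {m n} → m < suc n * 10 → m / 10 ≤ n
m<[1+n]*10⇒m/10≤n = s≤s⁻¹ ∘ m<n*o⇒m/o<n

5*[1+2n]<[1+n]*10 : ∀ n → 5 * suc (2 * n) < suc n * 10
5*[1+2n]<[1+n]*10 n = begin-strict
  5 * suc (2 * n)     <⟨ m<m+n (5 * suc (2 * n)) {5} z<s ⟩
  5 * suc (2 * n) + 5 ≡⟨ solve (List.[ n ]) ⟩
  suc n * 10          ∎
  where open ≤-Reasoning

2*[2*[2*n]]<[1+n]*10 : ∀ n → 2 * (2 * (2 * n)) < suc n * 10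
2*[2*[2*n]]<[1+n]*10 n = begin-strict
  2 * (2 * (2 * n))                <⟨ m<m+n (2 * (2 * (2 * n))) {10 + 2 * n} z<s ⟩
  2 * (2 * (2 * n)) + (10 + 2 * n) ≡⟨ solve (List.[ n ]) ⟩
  suc n * 10                       ∎
  where open ≤-Reasoning

module GreedySelection
  {A : Set} {P : Pred A 0ℓ} {Compatible : Rel A 0ℓ} (compatible? : Decidable Compatible)
  (k : ℕ) (conflicts : A → List A) (length-conflicts : ∀ x → length (conflicts x) ≤ k)
  (incompatible⇒conflict : ∀ {x y} → P x → P y → x ≢ y → ¬ Compatible x y → y ∈ conflicts x)
  where

  Selection : List A → Set
  Selection xs = ∃[ ys ] ys ⊆ xs × AllPairs Compatible ys × length xs ≤ suc k * length ys

  select-with-fuel : ∀ fuel xs → length xs ≤ fuel → Unique xs → All P xs → Selection xs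
  select-with-fuel _          []       _         _            _          = [] , (λ ()) , [] , z≤n
  select-with-fuel (suc fuel) (x ∷ xs) (s≤s len) (x∉xs ∷ xs!) (px ∷ pxs)
    with select-with-fuel fuel (filter (compatible? x) xs)
           (≤-trans (length-filter (compatible? x) xs) len)
           (Unique.filter⁺ (compatible? x) xs!) (All.filter⁺ (compatible? x) pxs)
  ... | ys , ys⊆kept , ys! , ys-bound =
    x ∷ ys , x∷ys⊆x∷xs , All.anti-mono ys⊆kept (All.all-filter (compatible? x) xs) ∷ ys! , bound
    where
    kept rejected : List A
    kept     = filter (compatible? x) xs
    rejected = filter (∁? (compatible? x)) xs

    x∷ys⊆x∷xs : x ∷ ys ⊆ x ∷ xs
    x∷ys⊆x∷xs (here refl)  = here refl
    x∷ys⊆x∷xs (there y∈ys) = there (proj₁ (∈-filter⁻ (compatible? x) (ys⊆kept y∈ys)))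

    rejected⊆conflicts : rejected ⊆ conflicts x
    rejected⊆conflicts y∈rejected with ∈-filter⁻ (∁? (compatible? x)) y∈rejected
    ... | y∈xs , incompatible =
      incompatible⇒conflict px (All.lookup pxs y∈xs) (All.lookup x∉xs y∈xs) incompatible

    few-rejected : length rejected ≤ k
    few-rejected =
      ≤-trans (Unique∧⊆⇒length≤ (Unique.filter⁺ _ xs!) rejected⊆conflicts) (length-conflicts x)

    open ≤-Reasoning
    bound : suc (length xs) ≤ suc k * suc (length ys)
    bound = begin
      suc (length xs)                     ≡⟨ cong suc (length-filter+filter-∁ (compatible? x) xs) ⟩
      suc (length kept + length rejected) ≤⟨ s≤s (+-mono-≤ ys-bound few-rejected) ⟩
      suc (suc k * length ys + k)         ≡⟨ cong suc (+-comm _ k) ⟩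
      suc (k + suc k * length ys)         ≡⟨ sym (*-suc (suc k) (length ys)) ⟩
      suc k * suc (length ys)             ∎

  select : ∀ xs → Unique xs → All P xs → Selection xs
  select xs = select-with-fuel (length xs) xs ≤-refl

module Transpositions {A : Set} (_≟_ : DecidableEquality A) where

  transpose : A → A → A → A
  transpose a b x with x ≟ a
  ... | yes _ = b
  ... | no  _ with x ≟ b
  ...   | yes _ = a
  ...   | no  _ = x

  transpose-sendsˡ : ∀ a b → transpose a b a ≡ b
  transpose-sendsˡ a b with a ≟ a
  ... | yes _   = refl
  ... | no  a≢a = ⊥-elim (a≢a refl)

  transpose-sendsʳ : ∀ a b → transpose a b b ≡ a
  transpose-sendsʳ a b with b ≟ a
  ... | yes b≡a = b≡a
  ... | no  _ with b ≟ b
  ...   | yes _   = refl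
  ...   | no  b≢b = ⊥-elim (b≢b refl)

  transpose-fixes : ∀ {a b x} → x ≢ a → x ≢ b → transpose a b x ≡ x
  transpose-fixes {a} {b} {x} x≢a x≢b with x ≟ a
  ... | yes x≡a = ⊥-elim (x≢a x≡a)
  ... | no  _ with x ≟ b
  ...   | yes x≡b = ⊥-elim (x≢b x≡b)
  ...   | no  _   = refl

  transpose-involutive : ∀ a b x → transpose a b (transpose a b x) ≡ x
  transpose-involutive a b x with x ≟ a
  ... | yes refl = transpose-sendsʳ x b
  ... | no  x≢a with x ≟ b
  ...   | yes refl = transpose-sendsˡ a x
  ...   | no  x≢b  = transpose-fixes x≢a x≢b

  Apart : Rel (A × A) 0ℓ
  Apart (p , q) (p′ , q′) = p ≢ p′ × q ≢ q′

  extend extend⁻¹ : List (A × A) → A → A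
  extend []             = id
  extend ((p , q) ∷ ps) = transpose (extend ps p) q ∘ extend ps
  extend⁻¹ []             = id
  extend⁻¹ ((p , q) ∷ ps) = extend⁻¹ ps ∘ transpose (extend ps p) q

  extend⁻¹-extend : ∀ ps x → extend⁻¹ ps (extend ps x) ≡ x
  extend⁻¹-extend []             x = refl
  extend⁻¹-extend ((p , q) ∷ ps) x = trans
    (cong (extend⁻¹ ps) (transpose-involutive (extend ps p) q (extend ps x)))
    (extend⁻¹-extend ps x)

  extend-extend⁻¹ : ∀ ps x → extend ps (extend⁻¹ ps x) ≡ x
  extend-extend⁻¹ []             x = refl
  extend-extend⁻¹ ((p , q) ∷ ps) x = trans
    (cong (transpose (extend ps p) q) (extend-extend⁻¹ ps (transpose (extend ps p) q x)))
    (transpose-involutive (extend ps p) q x)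

  extend-injective : ∀ ps {x y} → extend ps x ≡ extend ps y → x ≡ y
  extend-injective ps {x} {y} eq = begin
    x                           ≡⟨ extend⁻¹-extend ps x ⟨
    extend⁻¹ ps (extend ps x)   ≡⟨ cong (extend⁻¹ ps) eq ⟩
    extend⁻¹ ps (extend ps y)   ≡⟨ extend⁻¹-extend ps y ⟩
    y                           ∎
    where open ≡-Reasoning

  -- The last transposition moves extend ps p to q; it fixes every other target q′ of ps,
  -- since q′ ≢ q and q′ = extend ps p′ with p′ ≢ p.
  extend-∈ : ∀ {ps p q} → AllPairs Apart ps → (p , q) ∈ ps → extend ps p ≡ q
  extend-∈ {(p , q) ∷ ps} _ (here refl) = transpose-sendsˡ (extend ps p) q
  extend-∈ {(p , q) ∷ ps} {p′} {q′} (apart ∷ ps!) (there pq′∈ps) = begin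
    transpose (extend ps p) q (extend ps p′) ≡⟨ cong (transpose (extend ps p) q) ih ⟩
    transpose (extend ps p) q q′             ≡⟨ transpose-fixes q′≢extend-p q′≢q ⟩
    q′                                       ∎
    where
    open ≡-Reasoning
    ih = extend-∈ ps! pq′∈ps
    q′≢extend-p : q′ ≢ extend ps p
    q′≢extend-p eq = proj₁ (All.lookup apart pq′∈ps) (extend-injective ps (trans (sym eq) (sym ih)))
    q′≢q : q′ ≢ q
    q′≢q eq = proj₂ (All.lookup apart pq′∈ps) (sym eq)

  extend-↔ : List (A × A) → A ↔ A
  extend-↔ ps = mk↔ₛ′ (extend ps) (extend⁻¹ ps) (extend-extend⁻¹ ps) (extend⁻¹-extend ps)

Unique-allConfigs : ∀ n → Unique (allConfigs n)
Unique-allConfigs zero    = [] ∷ []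
Unique-allConfigs (suc n) = Unique.++⁺ (Unique.map⁺ ∷-injectiveʳ (Unique-allConfigs n))
                                       (Unique.map⁺ ∷-injectiveʳ (Unique-allConfigs n))
                                       heads-differ
  where
  heads-differ : ∀ {v} → ¬ (v ∈ map (false ∷_) (allConfigs n) × v ∈ map (true ∷_) (allConfigs n))
  heads-differ (v∈ , v∈′) with ∈-map⁻ (false ∷_) v∈ | ∈-map⁻ (true ∷_) v∈′
  ... | _ , _ , refl | _ , _ , ()

length-allConfigs : ∀ n → length (allConfigs n) ≡ 2 ^ n
length-allConfigs zero    = refl
length-allConfigs (suc n) = begin
  length (map (false ∷_) cs List.++ map (true ∷_) cs)     ≡⟨ length-++ (map (false ∷_) cs) ⟩
  length (map (false ∷_) cs) + length (map (true ∷_) cs) ≡⟨ cong₂ _+_ (length-map _ cs) (length-map _ cs) ⟩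
  length cs + length cs                                   ≡⟨ cong (λ k → k + k) (length-allConfigs n) ⟩
  2 ^ n + 2 ^ n                                           ≡⟨ cong (2 ^ n +_) (+-identityʳ (2 ^ n)) ⟨
  2 ^ suc n                                               ∎
  where
  open ≡-Reasoning
  cs = allConfigs n

module _ {n : ℕ} where
  open DecMembership (_≟c_ {n}) using (_∈?_)

  ⟦_⟧ : List (Config n) → CSet n
  ⟦ xs ⟧ x = does (x ∈? xs)

  ∈⇒⟦⟧ : ∀ {xs x} → x ∈ xs → ⟦ xs ⟧ x ≡ true
  ∈⇒⟦⟧ {xs} {x} = dec-true (x ∈? xs)

  ∉⇒⟦⟧ : ∀ {xs x} → x ∉ xs → ⟦ xs ⟧ x ≡ false
  ∉⇒⟦⟧ {xs} {x} = dec-false (x ∈? xs)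

  ⟦⟧⇒∈ : ∀ {xs x} → ⟦ xs ⟧ x ≡ true → x ∈ xs
  ⟦⟧⇒∈ {xs} {x} x∈⟦xs⟧ with x ∈? xs
  ... | yes x∈xs = x∈xs
  ⟦⟧⇒∈ () | no _

  size-⟦⟧≤length : ∀ xs → size ⟦ xs ⟧ ≤ length xs
  size-⟦⟧≤length xs = Unique∧⊆⇒length≤ (Unique.filter⁺ member? (Unique-allConfigs n))
                                 (⟦⟧⇒∈ {xs} ∘ All.lookup (All.all-filter member? (allConfigs n)))
    where member? = λ x → ⟦ xs ⟧ x ≟ᵇ true

  DistinctSets-⟦⟧ : ∀ {xs ys x} → x ∈ xs → x ∉ ys → DistinctSets ⟦ xs ⟧ ⟦ ys ⟧
  DistinctSets-⟦⟧ x∈xs x∉ys =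
    _ , λ eq → true≢false (trans (sym (∈⇒⟦⟧ x∈xs)) (trans eq (∉⇒⟦⟧ x∉ys)))
    where true≢false : true ≢ false
          true≢false ()

module _ {n : ℕ} where

  conjugate : (Config n ↔ Config n) → F n → F n
  conjugate π f = Inverse.from π ∘ f ∘ Inverse.to π

  conjugate-∼ : ∀ π f → conjugate π f ∼ f
  conjugate-∼ π f = ↔⇒⤖ π , λ x y →
    (λ eq → trans (sym (strictlyInverseˡ (f (to x)))) (cong to eq)) ,
    (λ eq → trans (cong from eq) (strictlyInverseʳ y))
    where open Inverse π

  conjugate-step : ∀ π f {p p′ q} → Inverse.to π p ≡ q → Inverse.to π p′ ≡ f q → conjugate π f p ≡ p′
  conjugate-step π f {p} {p′} {q} πp≡q πp′≡fq = begin
    from (f (to p)) ≡⟨ cong (from ∘ f) πp≡q ⟩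
    from (f q)      ≡⟨ cong from πp′≡fq ⟨
    from (to p′)    ≡⟨ strictlyInverseʳ p′ ⟩
    p′              ∎
    where open Inverse π
          open ≡-Reasoning

module _ {n : ℕ} (h : F n) where

  FlipsWithin : List (Config n) → Config n → Config n → Set
  FlipsWithin xs x v = ∀ i → lookup v i ≢ lookup x i → flipAt i x ∈ xs

  ArcsWithin : List (Config n) → Set
  ArcsWithin xs = ∀ {x} → x ∈ xs → FlipsWithin xs x (h x)

  TrapConnected : List (Config n) → Set
  TrapConnected xs = ∀ S → Trap h S → ∀ {x} → x ∈ xs → S x ≡ true → All (λ y → S y ≡ true) xs

  attractor-⟦⟧ : ∀ {x xs} → x ∈ xs → ArcsWithin xs → TrapConnected xs → Attractor h ⟦ xs ⟧
  attractor-⟦⟧ {xs = xs} x∈xs arcs-within connected = (_ , ∈⇒⟦⟧ x∈xs) , trap , minimal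
    where
    trap : Trap h ⟦ xs ⟧
    trap x y x∈ (i , differs , refl) = ∈⇒⟦⟧ (arcs-within (⟦⟧⇒∈ x∈) i differs)
    minimal : ∀ T → T Defs.⊆ ⟦ xs ⟧ → NonEmpty T → Trap h T → ⟦ xs ⟧ Defs.⊆ T
    minimal T T⊆ (z , z∈T) T-trap y y∈ =
      All.lookup (connected T T-trap (⟦⟧⇒∈ (T⊆ z z∈T)) z∈T) (⟦⟧⇒∈ {xs = xs} y∈)

  arc : ∀ {x v} i → h x ≡ v → lookup v i ≢ lookup x i → AArc h x (flipAt i x)
  arc i refl differs = i , differs , refl

  fixedPoint-attractor : ∀ {x} → h x ≡ x → Attractor h ⟦ [ x ] ⟧
  fixedPoint-attractor {x} hx≡x = attractor-⟦⟧ (here refl) arcs-within connected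
    where
    arcs-within : ArcsWithin [ x ]
    arcs-within (here refl) = subst (FlipsWithin [ x ] x) (sym hx≡x) λ _ differs → ⊥-elim (differs refl)
    connected : TrapConnected [ x ]
    connected _ _ (here refl) Sx = Sx ∷ []

b000 b100 b010 b110 b101 b111 : Vec Bool 3
b000 = false ∷ false ∷ false ∷ []
b100 = true  ∷ false ∷ false ∷ []
b010 = false ∷ true  ∷ false ∷ []
b110 = true  ∷ true  ∷ false ∷ []
b101 = true  ∷ false ∷ true  ∷ []
b111 = true  ∷ true  ∷ true  ∷ []

module _ {m : ℕ} (h : F (3 + m)) (t : Vec Bool m) where

  private
    c000 c100 c010 c110 c101 c111 : Config (3 + m)
    c000 = b000 ++ t
    c100 = b100 ++ t
    c010 = b010 ++ t
    c110 = b110 ++ t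
    c101 = b101 ++ t
    c111 = b111 ++ t

  twoCycle-attractor : h c000 ≡ c100 → h c100 ≡ c000 → Attractor h ⟦ c000 ∷ c100 ∷ [] ⟧
  twoCycle-attractor h000 h100 = attractor-⟦⟧ h (here refl) arcs-within connected
    where
    xs = c000 ∷ c100 ∷ []
    arcs-within : ArcsWithin h xs
    arcs-within (here refl) = subst (FlipsWithin h xs c000) (sym h000)
      λ { zero _ → there (here refl) ; (suc i) differs → ⊥-elim (differs refl) }
    arcs-within (there (here refl)) = subst (FlipsWithin h xs c100) (sym h100)
      λ { zero _ → here refl ; (suc i) differs → ⊥-elim (differs refl) }
    connected : TrapConnected h xs
    connected S trap (here refl) S000 = S000 ∷ trap _ _ S000 (arc h zero h000 λ ()) ∷ []
    connected S trap (there (here refl)) S100 = trap _ _ S100 (arc h zero h100 λ ()) ∷ S100 ∷ []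

  -- The arcs of 𝒜(h) leaving these corners are the edges of the path 000 – 100 – 110 – 111,
  -- in both directions: h moves 000 and 111 in one bit, 100 and 110 in two.
  path-attractor : h c000 ≡ c100 → h c100 ≡ c010 → h c110 ≡ c101 → h c111 ≡ c110 →
                   Attractor h ⟦ c000 ∷ c100 ∷ c110 ∷ c111 ∷ [] ⟧
  path-attractor h000 h100 h110 h111 = attractor-⟦⟧ h (here refl) arcs-within connected
    where
    xs = c000 ∷ c100 ∷ c110 ∷ c111 ∷ []
    arcs-within : ArcsWithin h xs
    arcs-within (here refl) = subst (FlipsWithin h xs c000) (sym h000)
      λ { zero _ → there (here refl) ; (suc i) differs → ⊥-elim (differs refl) }
    arcs-within (there (here refl)) = subst (FlipsWithin h xs c100) (sym h100)
      λ { zero _ → here refl ; (suc zero) _ → there (there (here refl))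
        ; (suc (suc i)) differs → ⊥-elim (differs refl) }
    arcs-within (there (there (here refl))) = subst (FlipsWithin h xs c110) (sym h110)
      λ { zero differs → ⊥-elim (differs refl) ; (suc zero) _ → there (here refl)
        ; (suc (suc zero)) _ → there (there (there (here refl)))
        ; (suc (suc (suc i))) differs → ⊥-elim (differs refl) }
    arcs-within (there (there (there (here refl)))) = subst (FlipsWithin h xs c111) (sym h111)
      λ { (suc (suc zero)) _ → there (there (here refl))
        ; zero differs → ⊥-elim (differs refl) ; (suc zero) differs → ⊥-elim (differs refl)
        ; (suc (suc (suc i))) differs → ⊥-elim (differs refl) }
    connected : TrapConnected h xs
    connected S trap = from
      where
      step : ∀ {x v} i → h x ≡ v → lookup v i ≢ lookup x i → S x ≡ true → S (flipAt i x) ≡ true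
      step i hx differs Sx = trap _ _ Sx (arc h i hx differs)
      from100 : S c100 ≡ true → All (λ y → S y ≡ true) xs
      from100 S100 = step zero h100 (λ ()) S100 ∷ S100 ∷ S110 ∷ step (suc (suc zero)) h110 (λ ()) S110 ∷ []
        where S110 = step (suc zero) h100 (λ ()) S100
      from : ∀ {x} → x ∈ xs → S x ≡ true → All (λ y → S y ≡ true) xs
      from (here refl) S000 = from100 (step zero h000 (λ ()) S000)
      from (there (here refl)) S100 = from100 S100
      from (there (there (here refl))) S110 = from100 (step (suc zero) h110 (λ ()) S110)
      from (there (there (there (here refl)))) S111 =
        from100 (step (suc zero) h110 (λ ()) (step (suc (suc zero)) h111 (λ ()) S111))

module Segments {n : ℕ} (f : F n) where
  open DecDisjoint (_≟c_ {n}) using (disjoint?)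

  segment : Config n → List (Config n)
  segment x = x ∷ f x ∷ f (f x) ∷ []

  nearby : Config n → List (Config n)
  nearby x = x ∷ f x ∷ f (f (f x)) ∷ f (f (f (f x))) ∷ []

  -- If f^i x′ = f^j x with i, j ≤ 2, then f² x′ = f^(2 - i + j) x.
  meet⇒nearby : ∀ {x x′ v} → f (f x′) ≢ f (f x) → v ∈ segment x′ → v ∈ segment x → f (f x′) ∈ nearby x
  meet⇒nearby ne (here refl)                 (here b)                 = ⊥-elim (ne (cong (f ∘ f) b))
  meet⇒nearby _  (here refl)                 (there (here b))         = there (there (here (cong (f ∘ f) b)))
  meet⇒nearby _  (here refl)                 (there (there (here b))) = there (there (there (here (cong (f ∘ f) b))))
  meet⇒nearby _  (there (here refl))         (here b)                 = there (here (cong f b))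
  meet⇒nearby ne (there (here refl))         (there (here b))         = ⊥-elim (ne (cong f b))
  meet⇒nearby _  (there (here refl))         (there (there (here b))) = there (there (here (cong f b)))
  meet⇒nearby _  (there (there (here refl))) (here b)                 = here b
  meet⇒nearby _  (there (there (here refl))) (there (here b))         = there (here b)
  meet⇒nearby ne (there (there (here refl))) (there (there (here b))) = ⊥-elim (ne b)

  HasPreimage : Config n → Set
  HasPreimage y = Any (λ x → f (f x) ≡ y) (allConfigs n)

  hasPreimage? : Decidable₁ HasPreimage
  hasPreimage? y = any? (λ x → f (f x) ≟c y) (allConfigs n)

  images : List (Config n)
  images = filter hasPreimage? (allConfigs n)

  imageCount2≤2^n : imageCount2 f ≤ 2 ^ n
  imageCount2≤2^n = ≤-trans (length-filter hasPreimage? (allConfigs n)) (≤-reflexive (length-allConfigs n))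

  -- An arbitrary value where y has no preimage under f²; only used for y ∈ images.
  preimage : Config n → Config n
  preimage y with hasPreimage? y
  ... | yes found = proj₁ (satisfied found)
  ... | no  _     = y

  f²-preimage : ∀ {y} → y ∈ images → f (f (preimage y)) ≡ y
  f²-preimage {y} y∈images with hasPreimage? y | proj₂ (∈-filter⁻ hasPreimage? {xs = allConfigs n} y∈images)
  ... | yes found | _     = proj₂ (satisfied found)
  ... | no  none  | found = ⊥-elim (none found)

  disjoint-segments : ∃[ xs ] AllPairs (Disjoint on segment) xs × imageCount2 f ≤ 5 * length xs
  disjoint-segments
    with select images (Unique.filter⁺ hasPreimage? (Unique-allConfigs n)) (All.tabulate {xs = images} f²-preimage)
    where
    incompatible⇒nearby : ∀ {y y′} → f (f (preimage y)) ≡ y → f (f (preimage y′)) ≡ y′ → y ≢ y′ →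
                          ¬ Disjoint (segment (preimage y)) (segment (preimage y′)) → y′ ∈ nearby (preimage y)
    incompatible⇒nearby y-image y′-image y≢y′ meet with ¬Disjoint⇒common _≟c_ meet
    ... | _ , v∈ , v∈′ = subst (_∈ nearby _) y′-image (meet⇒nearby images-differ v∈′ v∈)
      where images-differ = λ eq → y≢y′ (trans (sym y-image) (trans (sym eq) y′-image))
    open GreedySelection {P = λ y → f (f (preimage y)) ≡ y}
           (λ y y′ → disjoint? (segment (preimage y)) (segment (preimage y′)))
           4 (nearby ∘ preimage) (λ _ → ≤-refl) incompatible⇒nearby
  ... | ys , _ , ys! , bound =
    map preimage ys , AllPairs.map⁺ ys! ,
    subst (λ k → imageCount2 f ≤ 5 * k) (sym (length-map preimage ys)) bound

module Gadgets {n : ℕ} (f : F n) where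
  open Segments f

  data Gadget : Set where
    fixedPoint : (p : Config n) → f p ≡ p → Gadget
    twoCycle   : (p : Config n) → f p ≢ p → f (f p) ≡ p → Gadget
    twoPaths   : (x x′ : Config n) → Unique (segment x List.++ segment x′) → Gadget

  points : Gadget → List (Config n)
  points (fixedPoint p _)   = [ p ]
  points (twoCycle p _ _)   = p ∷ f p ∷ []
  points (twoPaths x x′ _)  = segment x List.++ segment x′

  Unique-points : ∀ g → Unique (points g)
  Unique-points (fixedPoint _ _)     = [] ∷ []
  Unique-points (twoCycle _ fp≢p _)  = ((fp≢p ∘ sym) ∷ []) ∷ [] ∷ []
  Unique-points (twoPaths _ _ xx′!)  = xx′!

  data SegmentShape (x : Config n) : Set where
    short : (g : Gadget) → points g ⊆ segment x → SegmentShape x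
    long  : Unique (segment x) → SegmentShape x

  segmentShape : ∀ x → SegmentShape x
  segmentShape x with f x ≟c x
  ... | yes fx≡x = short (fixedPoint x fx≡x) λ { (here refl) → here refl }
  ... | no  fx≢x with f (f x) ≟c x
  ...   | yes f²x≡x = short (twoCycle x fx≢x f²x≡x)
                        λ { (here refl) → here refl ; (there (here refl)) → there (here refl) }
  ...   | no  f²x≢x with f (f x) ≟c f x
  ...     | yes f²x≡fx = short (fixedPoint (f x) f²x≡fx) λ { (here refl) → there (here refl) }
  ...     | no  f²x≢fx =
    long (((fx≢x ∘ sym) ∷ (f²x≢x ∘ sym) ∷ []) ∷ ((f²x≢fx ∘ sym) ∷ []) ∷ [] ∷ [])

  gadget : ∀ u v → Disjoint (segment u) (segment v) → Gadget
  gadget u v u#v with segmentShape u | segmentShape v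
  ... | short g _ | _         = g
  ... | long _    | short g _ = g
  ... | long u!   | long v!   = twoPaths u v (Unique.++⁺ u! v! u#v)

  points-gadget : ∀ u v (u#v : Disjoint (segment u) (segment v)) →
                  points (gadget u v u#v) ⊆ segment u List.++ segment v
  points-gadget u v u#v with segmentShape u | segmentShape v
  ... | short g g⊆u | _           = ∈-++⁺ˡ ∘ g⊆u
  ... | long _      | short g g⊆v = ∈-++⁺ʳ (segment u) ∘ g⊆v
  ... | long _      | long _      = id

  gadgets : ∀ xs → AllPairs (Disjoint on segment) xs → List Gadget
  gadgets []           _                         = []
  gadgets (_ ∷ [])     _                         = []
  gadgets (u ∷ v ∷ xs) ((u#v ∷ _) ∷ (_ ∷ xs!)) = gadget u v u#v ∷ gadgets xs xs!

  length-gadgets : ∀ xs xs! → length xs ≤ suc (2 * length (gadgets xs xs!))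
  length-gadgets []           _                      = z≤n
  length-gadgets (_ ∷ [])     _                      = s≤s z≤n
  length-gadgets (u ∷ v ∷ xs) ((_ ∷ _) ∷ (_ ∷ xs!)) =
    subst (λ k → 2 + length xs ≤ suc k) (sym (*-suc 2 _)) (s≤s (s≤s (length-gadgets xs xs!)))

  gadgets-disjoint-from : ∀ {w} xs xs! → All (Disjoint (segment w) ∘ segment) xs →
                          All (Disjoint (segment w) ∘ points) (gadgets xs xs!)
  gadgets-disjoint-from []           _                        _ = []
  gadgets-disjoint-from (_ ∷ [])     _                        _ = []
  gadgets-disjoint-from (u ∷ v ∷ xs) ((u#v ∷ _) ∷ (_ ∷ xs!)) (w#u ∷ w#v ∷ w#xs) =
    w#gadget ∷ gadgets-disjoint-from xs xs! w#xs
    where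
    w#gadget : Disjoint (segment _) (points (gadget u v u#v))
    w#gadget (p∈w , p∈g) with ∈-++⁻ (segment u) (points-gadget u v u#v p∈g)
    ... | inj₁ p∈u = w#u (p∈w , p∈u)
    ... | inj₂ p∈v = w#v (p∈w , p∈v)

  gadgets-disjoint : ∀ xs xs! → AllPairs (Disjoint on points) (gadgets xs xs!)
  gadgets-disjoint []           _                             = []
  gadgets-disjoint (_ ∷ [])     _                             = []
  gadgets-disjoint (u ∷ v ∷ xs) ((u#v ∷ u#xs) ∷ (v#xs ∷ xs!′)) =
    head#rest ∷ gadgets-disjoint xs xs!′
    where
    head#gadget : ∀ {g} → Disjoint (segment u) (points g) × Disjoint (segment v) (points g) →
                  Disjoint (points (gadget u v u#v)) (points g)
    head#gadget (u#g , v#g) (p∈head , p∈g) with ∈-++⁻ (segment u) (points-gadget u v u#v p∈head)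
    ... | inj₁ p∈u = u#g (p∈u , p∈g)
    ... | inj₂ p∈v = v#g (p∈v , p∈g)
    head#rest : All (Disjoint (points (gadget u v u#v)) ∘ points) (gadgets xs xs!′)
    head#rest = All.zipWith (λ {g} → head#gadget {g})
      (gadgets-disjoint-from {u} xs xs!′ u#xs , gadgets-disjoint-from {v} xs xs!′ v#xs)

module Layout {m : ℕ} (f : F (3 + m)) (xs : List (Config (3 + m)))
              (xs! : AllPairs (Disjoint on Segments.segment f) xs) where
  open Segments f
  open Gadgets f
  open Transpositions (_≟c_ {3 + m})

  corners : Gadget → List (Vec Bool 3)
  corners (fixedPoint _ _) = b000 ∷ []
  corners (twoCycle _ _ _) = b000 ∷ b100 ∷ []
  corners (twoPaths _ _ _) = b000 ∷ b100 ∷ b010 ∷ b111 ∷ b110 ∷ b101 ∷ []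

  attractorCorners : Gadget → List (Vec Bool 3)
  attractorCorners (fixedPoint _ _) = b000 ∷ []
  attractorCorners (twoCycle _ _ _) = b000 ∷ b100 ∷ []
  attractorCorners (twoPaths _ _ _) = b000 ∷ b100 ∷ b110 ∷ b111 ∷ []

  Unique-corners : ∀ g → Unique (corners g)
  Unique-corners (fixedPoint _ _) = [] ∷ []
  Unique-corners (twoCycle _ _ _) = ((λ ()) ∷ []) ∷ [] ∷ []
  Unique-corners (twoPaths _ _ _) =
    ((λ ()) ∷ (λ ()) ∷ (λ ()) ∷ (λ ()) ∷ (λ ()) ∷ []) ∷ ((λ ()) ∷ (λ ()) ∷ (λ ()) ∷ (λ ()) ∷ []) ∷
    ((λ ()) ∷ (λ ()) ∷ (λ ()) ∷ []) ∷ ((λ ()) ∷ (λ ()) ∷ []) ∷ ((λ ()) ∷ []) ∷ [] ∷ []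

  TaggedGadget : Set
  TaggedGadget = Gadget × Vec Bool m

  slots region : TaggedGadget → List (Config (3 + m))
  slots  (g , t) = map (_++ t) (corners g)
  region (g , t) = map (_++ t) (attractorCorners g)

  -- For two paths x, x′ the corners 000, 100, 010, 111, 110, 101 receive x, f x, f² x, x′, f x′, f² x′.
  placement : TaggedGadget → List (Config (3 + m) × Config (3 + m))
  placement (g , t) = zip (slots (g , t)) (points g)

  Separated : Rel TaggedGadget 0ℓ
  Separated (g , t) (g′ , t′) = Disjoint (points g) (points g′) × t ≢ t′

  tags-differ : ∀ {t t′ : Vec Bool m} {bs bs′ : List (Vec Bool 3)} {s s′ : Config (3 + m)} →
                 t ≢ t′ → s ∈ map (_++ t) bs → s′ ∈ map (_++ t′) bs′ → s ≢ s′
  tags-differ t≢t′ s∈ s′∈ refl with ∈-map⁻ _ s∈ | ∈-map⁻ _ s′∈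
  ... | b , _ , refl | b′ , _ , eq = t≢t′ (++-injectiveʳ b b′ eq)

  Unique-slots : ∀ z → Unique (slots z)
  Unique-slots (g , t) = Unique.map⁺ (++-injectiveˡ _ _) (Unique-corners g)

  placement-apart : ∀ z → AllPairs Apart (placement z)
  placement-apart (g , t) = AllPairs-zip⁺ (Unique-slots (g , t)) (Unique-points g)

  separated⇒apart : ∀ {z z′} → Separated z z′ → All (λ e → All (Apart e) (placement z′)) (placement z)
  separated⇒apart {g , t} {g′ , t′} (g#g′ , t≢t′) =
    All.map (λ (s∈ , p∈) → All.map (λ (s′∈ , p′∈) → tags-differ t≢t′ s∈ s′∈ , λ { refl → g#g′ (p∈ , p′∈) })
                                   (entries (g′ , t′)))
            (entries (g , t))
    where
    entries : ∀ ((g , t) : TaggedGadget) →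
              All (λ (s , p) → s ∈ slots (g , t) × p ∈ points g) (placement (g , t))
    entries (g , t) = All-zip⁺ (All.tabulate id) (All.tabulate id)

  layout-apart : ∀ {zs} → AllPairs Separated zs → AllPairs Apart (concatMap placement zs)
  layout-apart zs! = AllPairs.concat⁺ (All.map⁺ (All.tabulate (λ {z} _ → placement-apart z)))
                                      (AllPairs.map⁺ (AllPairs.map separated⇒apart zs!))

  gs : List Gadget
  gs = gadgets xs xs!

  zs : List TaggedGadget
  zs = zip gs (allConfigs m)

  zs-separated : AllPairs Separated zs
  zs-separated = AllPairs-zip⁺ (gadgets-disjoint xs xs!) (Unique-allConfigs m)

  π : Config (3 + m) ↔ Config (3 + m)
  π = extend-↔ (concatMap placement zs)

  h : F (3 + m)
  h = conjugate π f

  h-moves : ∀ {z p q p′} → z ∈ zs → (p , q) ∈ placement z → (p′ , f q) ∈ placement z → h p ≡ p′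
  h-moves {z} z∈zs pq∈ p′fq∈ = conjugate-step π f (sends pq∈) (sends p′fq∈)
    where
    sends : ∀ {p q} → (p , q) ∈ placement z → extend (concatMap placement zs) p ≡ q
    sends pq∈ = extend-∈ (layout-apart zs-separated) (∈-concat⁺′ pq∈ (∈-map⁺ placement z∈zs))

  attractor-region : ∀ {z} → z ∈ zs → Attractor h ⟦ region z ⟧
  attractor-region {fixedPoint _ fp≡p , t} z∈zs =
    fixedPoint-attractor h (h-moves z∈zs (here refl) (here (cong (_ ,_) fp≡p)))
  attractor-region {twoCycle _ _ f²p≡p , t} z∈zs = twoCycle-attractor h t
    (h-moves z∈zs (here refl) (there (here refl)))
    (h-moves z∈zs (there (here refl)) (here (cong (_ ,_) f²p≡p)))
  attractor-region {twoPaths _ _ _ , t} z∈zs = path-attractor h t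
    (h-moves z∈zs (here refl) (there (here refl)))
    (h-moves z∈zs (there (here refl)) (there (there (here refl))))
    (h-moves z∈zs (there (there (there (there (here refl))))) (there (there (there (there (there (here refl)))))))
    (h-moves z∈zs (there (there (there (here refl)))) (there (there (there (there (here refl))))))

  size-region : ∀ z → size ⟦ region z ⟧ ≤ 4
  size-region z = ≤-trans (size-⟦⟧≤length (region z)) (length-region z)
    where
    length-region : ∀ z → length (region z) ≤ 4
    length-region (fixedPoint _ _ , _) = s≤s z≤n
    length-region (twoCycle _ _ _ , _) = s≤s (s≤s z≤n)
    length-region (twoPaths _ _ _ , _) = ≤-refl

  regions-distinct : ∀ {z z′} → Separated z z′ → DistinctSets ⟦ region z ⟧ ⟦ region z′ ⟧
  regions-distinct {g , t} {g′ , t′} (_ , t≢t′) =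
    DistinctSets-⟦⟧ (b000∈ g)
      λ b000∈′ → tags-differ {bs′ = attractorCorners g′} t≢t′ (b000∈ g) b000∈′ refl
    where
    b000∈ : ∀ g → b000 ++ t ∈ region (g , t)
    b000∈ (fixedPoint _ _) = here refl
    b000∈ (twoCycle _ _ _) = here refl
    b000∈ (twoPaths _ _ _) = here refl

  regions : List (CSet (3 + m))
  regions = map (⟦_⟧ ∘ region) zs

  All-attractors : All (Attractor h) regions
  All-attractors = All.map⁺ (All.tabulate {xs = zs} attractor-region)

  All-size≤4 : All (λ S → size S ≤ 4) regions
  All-size≤4 = All.map⁺ (All.tabulate {xs = zs} λ {z} _ → size-region z)

  regions-pairwise-distinct : AllPairs DistinctSets regions
  regions-pairwise-distinct =
    AllPairs.map⁺ (AllPairs.map (λ {z z′} → regions-distinct {z} {z′}) zs-separated)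

  length-regions : imageCount2 f ≤ 5 * length xs → imageCount2 f / 10 ≤ length regions
  length-regions few-segments = begin
    imageCount2 f / 10                  ≤⟨ ⊓-glb (m<[1+n]*10⇒m/10≤n few-gadgets)
                                                 (m<[1+n]*10⇒m/10≤n few-tags) ⟩
    length gs ⊓ length (allConfigs m)   ≡⟨ length-zipWith _,_ gs (allConfigs m) ⟨
    length zs                           ≡⟨ length-map (⟦_⟧ ∘ region) zs ⟨
    length regions                      ∎
    where
    open ≤-Reasoning
    few-gadgets : imageCount2 f < suc (length gs) * 10
    few-gadgets = ≤-<-trans (≤-trans few-segments (*-monoʳ-≤ 5 (length-gadgets xs xs!)))
                            (5*[1+2n]<[1+n]*10 (length gs))
    few-tags : imageCount2 f < suc (length (allConfigs m)) * 10
    few-tags = subst (λ k → imageCount2 f < suc k * 10) (sym (length-allConfigs m))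
                     (≤-<-trans imageCount2≤2^n (2*[2*[2*n]]<[1+n]*10 (2 ^ m)))

imageCount2/10≤0 : ∀ {n} (f : F n) → 2 ^ n < 10 → imageCount2 f / 10 ≤ 0
imageCount2/10≤0 f 2^n<10 = ≤-reflexive (m<n⇒m/n≡0 (≤-<-trans (Segments.imageCount2≤2^n f) 2^n<10))

lemma17 : (n : ℕ) (f : F n) →
    Σ (F n) λ h → (h ∼ f) × Σ (List (CSet n)) λ As →
      (imageCount2 f / 10 ≤ length As)
      × All (Attractor h) As
      × All (λ S → size S ≤ 4) As
      × AllPairs DistinctSets As
lemma17 0 f = f , conjugate-∼ (↔-id _) f , [] , imageCount2/10≤0 f (from-yes (2 ^ 0 <? 10)) , [] , [] , []
lemma17 1 f = f , conjugate-∼ (↔-id _) f , [] , imageCount2/10≤0 f (from-yes (2 ^ 1 <? 10)) , [] , [] , []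
lemma17 2 f = f , conjugate-∼ (↔-id _) f , [] , imageCount2/10≤0 f (from-yes (2 ^ 2 <? 10)) , [] , [] , []
lemma17 (suc (suc (suc m))) f with Segments.disjoint-segments f
... | xs , xs! , few-segments =
  h , conjugate-∼ π f , regions , length-regions few-segments ,
  All-attractors , All-size≤4 , regions-pairwise-distinct
  where open Layout f xs xs!
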